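{- For every integer $k\ge 4$, $T_k(k+4)=k+7$, and the complete bipartite graph $K_{3,k+3}$ is an extremal graph, i.e. a triangle-free graph on $k+6$ vertices containing no $k$-sparse set of $k+4$ vertices.
   Context: All graphs are finite and simple. A set $S$ of vertices of a graph $G$ is $k$-sparse if the induced subgraph $G[S]$ has maximum degree at most $k$. For integers $k\ge0$ and $j\ge1$, $T_k(j)$ denotes the minimum $n$ such that every triangle-free graph on $n$ vertices contains a $k$-sparse set of $j$ vertices. An extremal graph for $T_k(j)$ is a triangle-free graph on $T_k(j)-1$ vertices containing no $k$-sparse set of $j$ vertices. -}

module Defs where

open import Data.Nat using (ℕ; _≤_; _<?_; _+_)
open import Data.Fin using (Fin; toℕ)
open import Data.Fin.Subset using (Subset; _∈_; _∩_; ∣_∣)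
open import Data.Bool using (Bool; true; false; not; _xor_)
open import Data.Vec using (tabulate)
open import Data.Product using (Σ; _×_)
open import Relation.Nullary using (¬_)
open import Relation.Nullary.Decidable using (does)
open import Relation.Binary.PropositionalEquality using (_≡_)

record Graph (n : ℕ) : Set where
  field
    Adj   : Fin n → Fin n → Bool
    sym   : ∀ u v → Adj u v ≡ Adj v u
    irrefl : ∀ v → Adj v v ≡ false
open Graph public

Edge : ∀ {n} → Graph n → Fin n → Fin n → Set
Edge G u v = Adj G u v ≡ true

TriangleFree : ∀ {n} → Graph n → Set
TriangleFree G = ∀ a b c → ¬ (Edge G a b × Edge G b c × Edge G a c)

N : ∀ {n} → Graph n → Fin n → Subset n
N G v = tabulate (Adj G v)

Sparse : ∀ {n} → Graph n → ℕ → Subset n → Set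
Sparse G k S = ∀ v → v ∈ S → ∣ S ∩ N G v ∣ ≤ k

HasSparseSet : ∀ {n} → Graph n → ℕ → ℕ → Set
HasSparseSet {n} G k j = Σ (Subset n) λ S → (∣ S ∣ ≡ j) × Sparse G k S

Forces : ℕ → ℕ → ℕ → Set
Forces k j n = (G : Graph n) → TriangleFree G → HasSparseSet G k j

IsT : ℕ → ℕ → ℕ → Set
IsT k j m = Forces k j m × (∀ n → Forces k j n → m ≤ n)

-- extremal graph for T_k(j): triangle-free, on T_k(j) - 1 vertices (given as n
-- with T_k(j) = n + 1), with no k-sparse set of j vertices
IsExtremal : ∀ {n} → ℕ → ℕ → Graph n → Set
IsExtremal {n} k j G = IsT k j (n + 1) × TriangleFree G × ¬ HasSparseSet G k j

-- complete bipartite graph K_{a,b} on Fin (a + b): vertices with index < a form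
-- one side, the rest the other side; adjacent iff on different sides
side : ∀ {n} → ℕ → Fin n → Bool
side a v = does (toℕ v <? a)

Kab-Adj : ∀ a b → Fin (a + b) → Fin (a + b) → Bool
Kab-Adj a b u v = side a u xor side a v

private
  xor-sym : ∀ x y → x xor y ≡ y xor x
  xor-sym false false = Relation.Binary.PropositionalEquality.refl
  xor-sym false true = Relation.Binary.PropositionalEquality.refl
  xor-sym true false = Relation.Binary.PropositionalEquality.refl
  xor-sym true true = Relation.Binary.PropositionalEquality.refl
  xor-self : ∀ x → x xor x ≡ false
  xor-self false = Relation.Binary.PropositionalEquality.refl
  xor-self true = Relation.Binary.PropositionalEquality.refl

K : (a b : ℕ) → Graph (a + b)
K a b = record
  { Adj = Kab-Adj a b
  ; sym = λ u v → xor-sym (side a u) (side a v)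
  ; irrefl = λ v → xor-self (side a v)
  }

-- Call a vertex high if its degree exceeds k; a low vertex has at most k neighbours in any set.
-- If two high vertices u, w are adjacent, triangle-freeness makes N u and N w disjoint, so
-- N u ∪ N w has at least 2k + 2 ≥ k + 4 vertices; take S of size k + 4 inside it containing four
-- neighbours of u and four of w. A vertex of S adjacent to u is adjacent to none of the four
-- neighbours of u, so it has at most k neighbours in S (similarly for w). If the high vertices
-- are independent and there are at least four of them, any k + 4 vertices including four high
-- ones work for the same reason; if there are at most three, any k + 4 low vertices work.
-- Conversely, in K₃,ₘ with m ≤ k + 3 a set of k + 4 vertices meets the 3-side, and a vertex
-- there is adjacent to the at least k + 1 vertices of the set on the other side.

module Submission where

open import Defs hiding (sym)
open import Data.Bool using (Bool; true; false; _xor_)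
open import Data.Bool.Properties using (_≟_; ¬-not)
open import Data.Empty using (⊥-elim)
open import Data.Fin using (Fin)
open import Data.Fin.Properties using (any?)
open import Data.Fin.Subset
  using (Subset; inside; outside; _∈_; _∉_; _⊆_; _∩_; _∪_; ∁; ∣_∣; Nonempty; Empty)
open import Data.Fin.Subset.Properties
  using ( _∈?_; nonempty?; Empty-unique; ∣⊥∣≡0; ∣⊤∣≡n; ∣p∣≤n; ⊆⊤; ⊥⊆; ⊆-refl
        ; drop-∷-⊆; out⊆; in⊆in; s⊆s; p⊆q⇒∣p∣≤∣q∣; ∣∁p∣≡n∸∣p∣; x∈∁p⇒x∉p; x∉p⇒x∈∁p; x∉∁p⇒x∈p
        ; x∈p∩q⁺; x∈p∩q⁻; x∈p∪q⁺; x∈p∪q⁻; ∣p∩q∣≤∣q∣ )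
open import Data.Nat using (ℕ; zero; suc; _+_; _∸_; _≤_; _<_; z≤n; s≤s)
open import Data.Nat.Properties hiding (_≟_)
open import Data.Product using (∃-syntax; _×_; _,_; proj₁; proj₂; uncurry)
open import Data.Sum using (inj₁; inj₂; [_,_]) renaming (map to ⊎-map)
open import Function using (case_of_)
open import Data.Vec using ([]; _∷_; tabulate; here)
open import Data.Vec.Properties using (lookup∘tabulate; []=⇒lookup; lookup⇒[]=)
open import Relation.Nullary using (¬_; yes; no; does)
open import Relation.Nullary.Decidable using (dec-true; dec-false; decidable-stable; _×-dec_)
open import Relation.Binary.PropositionalEquality
  using (_≡_; refl; sym; trans; cong; cong₂; subst; subst₂; module ≡-Reasoning)

private
  variable
    n k j m : ℕ

Empty⇒∣p∣≡0 : {p : Subset n} → Empty p → ∣ p ∣ ≡ 0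
Empty⇒∣p∣≡0 {n} empty = trans (cong ∣_∣ (Empty-unique empty)) (∣⊥∣≡0 n)

∣p∪q∣+∣p∩q∣≡∣p∣+∣q∣ : (p q : Subset n) → ∣ p ∪ q ∣ + ∣ p ∩ q ∣ ≡ ∣ p ∣ + ∣ q ∣
∣p∪q∣+∣p∩q∣≡∣p∣+∣q∣ [] [] = refl
∣p∪q∣+∣p∩q∣≡∣p∣+∣q∣ (outside ∷ p) (outside ∷ q) = ∣p∪q∣+∣p∩q∣≡∣p∣+∣q∣ p q
∣p∪q∣+∣p∩q∣≡∣p∣+∣q∣ (inside ∷ p) (outside ∷ q) = cong suc (∣p∪q∣+∣p∩q∣≡∣p∣+∣q∣ p q)
∣p∪q∣+∣p∩q∣≡∣p∣+∣q∣ (outside ∷ p) (inside ∷ q) =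
  trans (cong suc (∣p∪q∣+∣p∩q∣≡∣p∣+∣q∣ p q)) (sym (+-suc ∣ p ∣ ∣ q ∣))
∣p∪q∣+∣p∩q∣≡∣p∣+∣q∣ (inside ∷ p) (inside ∷ q) = cong suc (begin
  ∣ p ∪ q ∣ + suc ∣ p ∩ q ∣  ≡⟨ +-suc ∣ p ∪ q ∣ ∣ p ∩ q ∣ ⟩
  suc (∣ p ∪ q ∣ + ∣ p ∩ q ∣) ≡⟨ cong suc (∣p∪q∣+∣p∩q∣≡∣p∣+∣q∣ p q) ⟩
  suc (∣ p ∣ + ∣ q ∣)         ≡⟨ sym (+-suc ∣ p ∣ ∣ q ∣) ⟩
  ∣ p ∣ + suc ∣ q ∣           ∎)
  where open ≡-Reasoning

∣p∪q∣≤∣p∣+∣q∣ : (p q : Subset n) → ∣ p ∪ q ∣ ≤ ∣ p ∣ + ∣ q ∣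
∣p∪q∣≤∣p∣+∣q∣ p q = ≤-trans (m≤m+n ∣ p ∪ q ∣ ∣ p ∩ q ∣) (≤-reflexive (∣p∪q∣+∣p∩q∣≡∣p∣+∣q∣ p q))

Empty-∩⇒∣p∪q∣≡∣p∣+∣q∣ : {p q : Subset n} → Empty (p ∩ q) → ∣ p ∪ q ∣ ≡ ∣ p ∣ + ∣ q ∣
Empty-∩⇒∣p∪q∣≡∣p∣+∣q∣ {p = p} {q} empty = begin
  ∣ p ∪ q ∣             ≡⟨ sym (+-identityʳ ∣ p ∪ q ∣) ⟩
  ∣ p ∪ q ∣ + 0         ≡⟨ cong (∣ p ∪ q ∣ +_) (sym (Empty⇒∣p∣≡0 empty)) ⟩
  ∣ p ∪ q ∣ + ∣ p ∩ q ∣ ≡⟨ ∣p∪q∣+∣p∩q∣≡∣p∣+∣q∣ p q ⟩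
  ∣ p ∣ + ∣ q ∣         ∎
  where open ≡-Reasoning

Empty-∩⇒∣p∣+∣q∣≤∣r∣ : {p q r : Subset n} → Empty (p ∩ q) → p ⊆ r → q ⊆ r → ∣ p ∣ + ∣ q ∣ ≤ ∣ r ∣
Empty-∩⇒∣p∣+∣q∣≤∣r∣ {p = p} {q} empty p⊆r q⊆r =
  subst (_≤ _) (Empty-∩⇒∣p∪q∣≡∣p∣+∣q∣ empty)
    (p⊆q⇒∣p∣≤∣q∣ λ x∈p∪q → [ p⊆r , q⊆r ] (x∈p∪q⁻ p q x∈p∪q))

∁q⊆r⇒∣p∣≤∣q∣+∣p∩r∣ : (p q r : Subset n) → ∁ q ⊆ r → ∣ p ∣ ≤ ∣ q ∣ + ∣ p ∩ r ∣
∁q⊆r⇒∣p∣≤∣q∣+∣p∩r∣ p q r ∁q⊆r =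
  ≤-trans (p⊆q⇒∣p∣≤∣q∣ p⊆q∪[p∩r]) (∣p∪q∣≤∣p∣+∣q∣ q (p ∩ r))
  where
  p⊆q∪[p∩r] : p ⊆ q ∪ (p ∩ r)
  p⊆q∪[p∩r] {x} x∈p with x ∈? q
  ... | yes x∈q = x∈p∪q⁺ (inj₁ x∈q)
  ... | no x∉q = x∈p∪q⁺ (inj₂ (x∈p∩q⁺ (x∈p , ∁q⊆r (x∉p⇒x∈∁p x∉q))))

∣∁q∣<∣p∣⇒Nonempty[p∩q] : {p q : Subset n} → ∣ ∁ q ∣ < ∣ p ∣ → Nonempty (p ∩ q)
∣∁q∣<∣p∣⇒Nonempty[p∩q] {p = p} {q} ∣∁q∣<∣p∣ = decidable-stable (nonempty? (p ∩ q)) λ empty →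
  <⇒≱ ∣∁q∣<∣p∣ (begin
    ∣ p ∣                 ≤⟨ ∁q⊆r⇒∣p∣≤∣q∣+∣p∩r∣ p (∁ q) q (λ x∈∁∁q → x∉∁p⇒x∈p (x∈∁p⇒x∉p x∈∁∁q)) ⟩
    ∣ ∁ q ∣ + ∣ p ∩ q ∣   ≡⟨ cong (∣ ∁ q ∣ +_) (Empty⇒∣p∣≡0 empty) ⟩
    ∣ ∁ q ∣ + 0          ≡⟨ +-identityʳ ∣ ∁ q ∣ ⟩
    ∣ ∁ q ∣              ∎)
  where open ≤-Reasoning

⊆-interpolate : {p q : Subset n} → p ⊆ q → ∣ p ∣ ≤ j → j ≤ ∣ q ∣ →
                ∃[ r ] p ⊆ r × r ⊆ q × ∣ r ∣ ≡ j
⊆-interpolate {p = []} {[]} _ _ z≤n = [] , ⊆-refl , ⊆-refl , refl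
⊆-interpolate {p = outside ∷ p} {outside ∷ q} p⊆q ∣p∣≤j j≤∣q∣
  with r , p⊆r , r⊆q , ∣r∣≡j ← ⊆-interpolate (drop-∷-⊆ p⊆q) ∣p∣≤j j≤∣q∣ =
  outside ∷ r , s⊆s p⊆r , s⊆s r⊆q , ∣r∣≡j
⊆-interpolate {p = inside ∷ p} {outside ∷ q} p⊆q _ _ with () ← p⊆q here
⊆-interpolate {p = inside ∷ p} {inside ∷ q} p⊆q (s≤s ∣p∣≤j) (s≤s j≤∣q∣)
  with r , p⊆r , r⊆q , ∣r∣≡j ← ⊆-interpolate (drop-∷-⊆ p⊆q) ∣p∣≤j j≤∣q∣ =
  inside ∷ r , in⊆in p⊆r , in⊆in r⊆q , cong suc ∣r∣≡j
⊆-interpolate {j = j} {outside ∷ p} {inside ∷ q} p⊆q ∣p∣≤j j≤1+∣q∣ with j ≤? ∣ q ∣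
... | yes j≤∣q∣ with r , p⊆r , r⊆q , ∣r∣≡j ← ⊆-interpolate (drop-∷-⊆ p⊆q) ∣p∣≤j j≤∣q∣ =
  outside ∷ r , s⊆s p⊆r , out⊆ r⊆q , ∣r∣≡j
... | no j≰∣q∣ = inside ∷ q , p⊆q , ⊆-refl , ≤-antisym (≰⇒> j≰∣q∣) j≤1+∣q∣

∃-⊆-of-size : {q : Subset n} → j ≤ ∣ q ∣ → ∃[ r ] r ⊆ q × ∣ r ∣ ≡ j
∃-⊆-of-size {n} {j} j≤∣q∣
  with r , _ , r⊆q , ∣r∣≡j ← ⊆-interpolate ⊥⊆ (subst (_≤ j) (sym (∣⊥∣≡0 n)) z≤n) j≤∣q∣ =
  r , r⊆q , ∣r∣≡j

⊆-interpolate-∪ : {p q r s : Subset n} → p ⊆ r → q ⊆ s → ∣ p ∣ + ∣ q ∣ ≤ j → j ≤ ∣ r ∪ s ∣ →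
                  ∃[ t ] p ⊆ t × q ⊆ t × t ⊆ r ∪ s × ∣ t ∣ ≡ j
⊆-interpolate-∪ {j = j} {p} {q} {r} {s} p⊆r q⊆s ∣p∣+∣q∣≤j j≤∣r∪s∣ =
  let t , p∪q⊆t , t⊆r∪s , ∣t∣≡j = ⊆-interpolate p∪q⊆r∪s ∣p∪q∣≤j j≤∣r∪s∣
  in t , (λ x∈p → p∪q⊆t (x∈p∪q⁺ (inj₁ x∈p))) , (λ x∈q → p∪q⊆t (x∈p∪q⁺ (inj₂ x∈q))) , t⊆r∪s , ∣t∣≡j
  where
  p∪q⊆r∪s : p ∪ q ⊆ r ∪ s
  p∪q⊆r∪s x∈p∪q = x∈p∪q⁺ (⊎-map p⊆r q⊆s (x∈p∪q⁻ p q x∈p∪q))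
  ∣p∪q∣≤j : ∣ p ∪ q ∣ ≤ j
  ∣p∪q∣≤j = ≤-trans (∣p∪q∣≤∣p∣+∣q∣ p q) ∣p∣+∣q∣≤j

x∈tabulate⁻ : {f : Fin n → Bool} {x : Fin n} → x ∈ tabulate f → f x ≡ true
x∈tabulate⁻ {f = f} {x} x∈ = trans (sym (lookup∘tabulate f x)) ([]=⇒lookup x∈)

x∈tabulate⁺ : {f : Fin n → Bool} {x : Fin n} → f x ≡ true → x ∈ tabulate f
x∈tabulate⁺ {f = f} {x} fx = lookup⇒[]= x (tabulate f) (trans (lookup∘tabulate f x) fx)

deg : Graph n → Fin n → ℕ
deg G v = ∣ N G v ∣

High : Graph n → ℕ → Subset n
High G k = tabulate λ v → does (k <? deg G v)

∈High⇒k<deg : (G : Graph n) {v : Fin n} → v ∈ High G k → k < deg G v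
∈High⇒k<deg {k = k} G {v} v∈H = decidable-stable (k <? deg G v) λ k≮deg →
  case trans (sym (dec-false (k <? deg G v) k≮deg)) (x∈tabulate⁻ v∈H) of λ ()

∉High⇒deg≤k : (G : Graph n) {v : Fin n} → v ∉ High G k → deg G v ≤ k
∉High⇒deg≤k {k = k} G {v} v∉H = ≮⇒≥ λ k<deg → v∉H (x∈tabulate⁺ (dec-true (k <? deg G v) k<deg))

adjacent⇒disjoint-N : (G : Graph n) → TriangleFree G → {u v x : Fin n} →
                      Edge G u v → x ∈ N G u → x ∉ N G v
adjacent⇒disjoint-N G tf {u} {v} {x} uv x∈Nu x∈Nv = tf u v x (uv , x∈tabulate⁻ x∈Nv , x∈tabulate⁻ x∈Nu)

non-neighbours⇒∣S∩N∣≤k : (G : Graph n) {S X : Subset n} {v : Fin n} →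
                         ∣ S ∣ ≡ k + m → X ⊆ S → m ≤ ∣ X ∣ → (∀ {x} → x ∈ X → x ∉ N G v) →
                         ∣ S ∩ N G v ∣ ≤ k
non-neighbours⇒∣S∩N∣≤k {k = k} {m} G {S} {X} {v} ∣S∣≡k+m X⊆S m≤∣X∣ X∌Nv = +-cancelˡ-≤ m _ _ (begin
  m + ∣ S ∩ N G v ∣     ≤⟨ +-monoˡ-≤ _ m≤∣X∣ ⟩
  ∣ X ∣ + ∣ S ∩ N G v ∣ ≤⟨ Empty-∩⇒∣p∣+∣q∣≤∣r∣ disjoint X⊆S (λ x∈ → proj₁ (x∈p∩q⁻ S (N G v) x∈)) ⟩
  ∣ S ∣                ≡⟨ ∣S∣≡k+m ⟩
  k + m                ≡⟨ +-comm k m ⟩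
  m + k                ∎)
  where
  open ≤-Reasoning
  disjoint : Empty (X ∩ (S ∩ N G v))
  disjoint (x , x∈) with x∈X , x∈S∩Nv ← x∈p∩q⁻ X _ x∈ = X∌Nv x∈X (proj₂ (x∈p∩q⁻ S (N G v) x∈S∩Nv))

few-high⇒HasSparseSet : (G : Graph n) → j ≤ n ∸ ∣ High G k ∣ → HasSparseSet G k j
few-high⇒HasSparseSet {j = j} {k} G j≤∣∁H∣
  with S , S⊆∁H , ∣S∣≡j ← ∃-⊆-of-size (subst (j ≤_) (sym (∣∁p∣≡n∸∣p∣ (High G k))) j≤∣∁H∣) =
  S , ∣S∣≡j , λ v v∈S → ≤-trans (∣p∩q∣≤∣q∣ S (N G v)) (∉High⇒deg≤k G (x∈∁p⇒x∉p (S⊆∁H v∈S)))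

independent-high⇒HasSparseSet : (G : Graph n) → k + m ≤ n → m ≤ ∣ High G k ∣ →
                                (∀ {u v} → u ∈ High G k → v ∈ High G k → ¬ Edge G u v) →
                                HasSparseSet G k (k + m)
independent-high⇒HasSparseSet {n} {k} {m} G k+m≤n m≤∣H∣ independent
  with X , X⊆H , ∣X∣≡m ← ∃-⊆-of-size m≤∣H∣
  with S , X⊆S , _ , ∣S∣≡k+m ← ⊆-interpolate ⊆⊤ (subst (_≤ k + m) (sym ∣X∣≡m) (m≤n+m m k))
                                                (subst (k + m ≤_) (sym (∣⊤∣≡n n)) k+m≤n) =
  S , ∣S∣≡k+m , sparse
  where
  sparse : Sparse G k S
  sparse v v∈S with v ∈? High G k
  ... | yes v∈H = non-neighbours⇒∣S∩N∣≤k G ∣S∣≡k+m X⊆S (≤-reflexive (sym ∣X∣≡m)) λ x∈X x∈Nv →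
                    independent v∈H (X⊆H x∈X) (x∈tabulate⁻ x∈Nv)
  ... | no v∉H = ≤-trans (∣p∩q∣≤∣q∣ S (N G v)) (∉High⇒deg≤k G v∉H)

adjacent⇒∣N∪N∣≡deg+deg : (G : Graph n) → TriangleFree G → {u w : Fin n} → Edge G u w →
                         ∣ N G u ∪ N G w ∣ ≡ deg G u + deg G w
adjacent⇒∣N∪N∣≡deg+deg G tf uw = Empty-∩⇒∣p∪q∣≡∣p∣+∣q∣ λ (x , x∈Nu∩Nw) →
  uncurry (adjacent⇒disjoint-N G tf uw) (x∈p∩q⁻ _ _ x∈Nu∩Nw)

adjacent-pair⇒HasSparseSet : (G : Graph n) → TriangleFree G → {u w : Fin n} → Edge G u w →
                             m ≤ k → m ≤ deg G u → m ≤ deg G w → k + m ≤ deg G u + deg G w →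
                             HasSparseSet G k (k + m)
adjacent-pair⇒HasSparseSet {m = m} {k} G tf {u} {w} uw m≤k m≤du m≤dw k+m≤du+dw
  with A , A⊆Nu , ∣A∣≡m ← ∃-⊆-of-size m≤du
  with B , B⊆Nw , ∣B∣≡m ← ∃-⊆-of-size m≤dw
  with S , A⊆S , B⊆S , S⊆Nu∪Nw , ∣S∣≡k+m ←
         ⊆-interpolate-∪ A⊆Nu B⊆Nw
           (subst (_≤ k + m) (cong₂ _+_ (sym ∣A∣≡m) (sym ∣B∣≡m)) (+-monoˡ-≤ m m≤k))
           (subst (k + m ≤_) (sym (adjacent⇒∣N∪N∣≡deg+deg G tf uw)) k+m≤du+dw) =
  S , ∣S∣≡k+m , λ v v∈S →
    [ ∈N⇒∣S∩N∣≤k A⊆Nu ∣A∣≡m A⊆S , ∈N⇒∣S∩N∣≤k B⊆Nw ∣B∣≡m B⊆S ] (x∈p∪q⁻ _ _ (S⊆Nu∪Nw v∈S))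
  where
  ∈N⇒∣S∩N∣≤k : ∀ {y Y} → Y ⊆ N G y → ∣ Y ∣ ≡ m → Y ⊆ S → ∀ {v} → v ∈ N G y → ∣ S ∩ N G v ∣ ≤ k
  ∈N⇒∣S∩N∣≤k Y⊆Ny ∣Y∣≡m Y⊆S v∈Ny =
    non-neighbours⇒∣S∩N∣≤k G ∣S∣≡k+m Y⊆S (≤-reflexive (sym ∣Y∣≡m)) λ x∈Y →
      adjacent⇒disjoint-N G tf (x∈tabulate⁻ v∈Ny) (Y⊆Ny x∈Y)

xor-triangle : ∀ x y z → x xor y ≡ true → y xor z ≡ true → ¬ x xor z ≡ true
xor-triangle false false _ ()
xor-triangle true  true  _ ()
xor-triangle false true false _ _ ()
xor-triangle false true true  _ ()
xor-triangle true false false _ ()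
xor-triangle true false true  _ _ ()

K-triangleFree : ∀ a b → TriangleFree (K a b)
K-triangleFree a b x y z (xy , yz , xz) = xor-triangle (side a x) (side a y) (side a z) xy yz xz

part₁ : ∀ a b → Subset (a + b)
part₁ a b = tabulate (side a)

∣part₁∣≡a : ∀ a b → ∣ part₁ a b ∣ ≡ a
∣part₁∣≡a zero b = Empty⇒∣p∣≡0 empty
  where
  empty : Empty (part₁ 0 b)
  empty (x , x∈) with () ← x∈tabulate⁻ {f = side 0} x∈
∣part₁∣≡a (suc a) b = cong suc (∣part₁∣≡a a b)

∣∁part₁∣≡b : ∀ a b → ∣ ∁ (part₁ a b) ∣ ≡ b
∣∁part₁∣≡b a b = trans (∣∁p∣≡n∸∣p∣ (part₁ a b)) (trans (cong (a + b ∸_) (∣part₁∣≡a a b)) (m+n∸m≡n a b))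

∁part₁⊆N : ∀ a b {y} → y ∈ part₁ a b → ∁ (part₁ a b) ⊆ N (K a b) y
∁part₁⊆N a b {y} y∈A {x} x∈∁A = x∈tabulate⁺ (cong₂ _xor_ (x∈tabulate⁻ y∈A) x∉side)
  where
  x∉side : side a x ≡ false
  x∉side = ¬-not λ x∈side → x∈∁p⇒x∉p x∈∁A (x∈tabulate⁺ x∈side)

K-noSparseSet : ∀ {a b} → b < j → k + a < j → ¬ HasSparseSet (K a b) k j
K-noSparseSet {j} {k} {a} {b} b<j k+a<j (S , ∣S∣≡j , sparse)
  with y , y∈S∩A ← ∣∁q∣<∣p∣⇒Nonempty[p∩q] (subst₂ _<_ (sym (∣∁part₁∣≡b a b)) (sym ∣S∣≡j) b<j)
  with y∈S , y∈A ← x∈p∩q⁻ S (part₁ a b) y∈S∩A = <⇒≱ k+a<j (begin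
    j                                   ≡⟨ sym ∣S∣≡j ⟩
    ∣ S ∣                               ≤⟨ ∁q⊆r⇒∣p∣≤∣q∣+∣p∩r∣ S (part₁ a b) _ (∁part₁⊆N a b y∈A) ⟩
    ∣ part₁ a b ∣ + ∣ S ∩ N (K a b) y ∣ ≤⟨ +-mono-≤ (≤-reflexive (∣part₁∣≡a a b)) (sparse y y∈S) ⟩
    a + k                               ≡⟨ +-comm a k ⟩
    k + a                               ∎)
  where open ≤-Reasoning

forces⇒j≤n : Forces k j n → j ≤ n
forces⇒j≤n {n = n} F with S , ∣S∣≡j , _ ← F (K 0 n) (K-triangleFree 0 n) = subst (_≤ n) ∣S∣≡j (∣p∣≤n S)

3+[k+4]≡k+7 : ∀ k → 3 + (k + 4) ≡ k + 7
3+[k+4]≡k+7 k = trans (cong (3 +_) (+-comm k 4)) (+-comm 7 k)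

forces⇒k+7≤n : Forces k (k + 4) n → k + 7 ≤ n
forces⇒k+7≤n {k} F
  with m , refl ← m≤n⇒∃[o]m+o≡n (≤-trans (≤-trans (n≤1+n 3) (m≤n+m 4 k)) (forces⇒j≤n F))
  with m <? k + 4
... | yes m<k+4 = ⊥-elim (K-noSparseSet m<k+4 (+-monoʳ-< k (n<1+n 3)) (F (K 3 m) (K-triangleFree 3 m)))
... | no m≮k+4 = subst (_≤ 3 + m) (3+[k+4]≡k+7 k) (+-monoʳ-≤ 3 (≮⇒≥ m≮k+4))

forces-k+7 : 4 ≤ k → Forces k (k + 4) (k + 7)
forces-k+7 {k} 4≤k G tf
  with any? (λ u → any? λ w → (u ∈? High G k) ×-dec (w ∈? High G k) ×-dec (Adj G u w ≟ true))
... | yes (u , w , u∈H , w∈H , uw) =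
  adjacent-pair⇒HasSparseSet G tf uw 4≤k (4≤deg u∈H) (4≤deg w∈H) k+4≤du+dw
  where
  4≤deg : ∀ {v} → v ∈ High G k → 4 ≤ deg G v
  4≤deg v∈H = ≤-trans 4≤k (<⇒≤ (∈High⇒k<deg G v∈H))
  k+4≤du+dw : k + 4 ≤ deg G u + deg G w
  k+4≤du+dw = begin
    k + 4             ≡⟨ +-suc k 3 ⟩
    suc k + 3         ≤⟨ +-mono-≤ (∈High⇒k<deg G u∈H) (≤-trans (n≤1+n 3) (4≤deg w∈H)) ⟩
    deg G u + deg G w ∎
    where open ≤-Reasoning
... | no no-high-edge with ∣ High G k ∣ ≤? 3
...   | yes ∣H∣≤3 = few-high⇒HasSparseSet G
        (≤-trans (≤-reflexive (sym (+-∸-assoc k (m≤m+n 3 4)))) (∸-monoʳ-≤ (k + 7) ∣H∣≤3))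
...   | no ∣H∣≰3 = independent-high⇒HasSparseSet G (+-monoʳ-≤ k (m≤m+n 4 3)) (≰⇒> ∣H∣≰3)
        λ u∈H v∈H uv → no-high-edge (_ , _ , u∈H , v∈H , uv)

theorem3p8 : (k : ℕ) → 4 ≤ k →
    IsT k (k + 4) (k + 7) × IsExtremal k (k + 4) (K 3 (k + 3))
theorem3p8 k 4≤k =
  isT , subst (IsT k (k + 4)) k+7≡3+[k+3]+1 isT , K-triangleFree 3 (k + 3) ,
  K-noSparseSet k+3<k+4 k+3<k+4
  where
  isT : IsT k (k + 4) (k + 7)
  isT = forces-k+7 4≤k , λ _ → forces⇒k+7≤n
  k+3<k+4 : k + 3 < k + 4
  k+3<k+4 = +-monoʳ-< k (n<1+n 3)
  k+7≡3+[k+3]+1 : k + 7 ≡ 3 + (k + 3) + 1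
  k+7≡3+[k+3]+1 = sym (trans (cong (3 +_) (+-assoc k 3 1)) (3+[k+4]≡k+7 k))
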